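{- Let $m,n\ge 2$ and let $f\colon V(K_m)\to V(K_n)$ be any function; write $Z=K_m\otimes_f K_n$. (i) If $m\le n$, then ${\rm gp}(Z)\ge v_{n-1}(Z)\ge (n-m+1)m$; in particular $\underline{{\rm gp}}_{\rm S}(K_m,K_n)\ge (n-m+1)m$. (ii) If $m\ge n$, then ${\rm gp}(Z)\ge \max\{2(n-1),m\}$; in particular $\underline{{\rm gp}}_{\rm S}(K_m,K_n)\ge \max\{2(n-1),m\}$.
   Context: $K_m$ is the complete graph on $m$ vertices. For a graph $Z$, $v_k(Z)$ is the number of vertices of $Z$ of degree $k$. A set $X$ of vertices of a connected graph is a general position set if no shortest path contains more than two vertices of $X$; ${\rm gp}$ denotes the maximum cardinality of a general position set. For graphs $G,H$ and $f\colon V(G)\to V(H)$, the Sierpiński product $G\otimes_f H$ has vertex set $V(G)\times V(H)$ and edges $(g,h)(g,h')$ for $g\in V(G)$, $hh'\in E(H)$, and $(g,f(g'))(g',f(g))$ for $gg'\in E(G)$. $\underline{{\rm gp}}_{\rm S}(G,H)=\min_f{\rm gp}(G\otimes_f H)$ over all functions $f\colon V(G)\to V(H)$. -}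

module Defs where

open import Data.Nat using (ℕ; zero; suc; _≤_; _≡ᵇ_)
open import Data.Fin using (Fin; _≟_)
open import Data.Bool using (Bool; true; false; _∧_; _∨_; not; T)
open import Data.Product using (_×_; _,_; ∃-syntax)
open import Data.List using (List; []; _∷_; length; filterᵇ; cartesianProduct; allFin)
open import Data.List.Membership.Propositional using (_∈_)
open import Data.List.Relation.Unary.Unique.Propositional using (Unique)
open import Relation.Nullary using (¬_; ⌊_⌋)
open import Relation.Binary.PropositionalEquality using (_≡_)

module _ {V : Set} (E : V → V → Set) where

  data Walk : V → V → Set where
    []  : ∀ {u} → Walk u u
    _∷_ : ∀ {u v w} → E u v → Walk v w → Walk u w

  len : ∀ {u v} → Walk u v → ℕ
  len []      = 0
  len (_ ∷ p) = suc (len p)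

  verts : ∀ {u v} → Walk u v → List V
  verts {u} []      = u ∷ []
  verts {u} (_ ∷ p) = u ∷ verts p

  -- a shortest u,v-path: a walk no longer than any other u,v-walk
  -- (such a walk is automatically a path)
  IsShortest : ∀ {u v} → Walk u v → Set
  IsShortest {u} {v} p = (q : Walk u v) → len p ≤ len q

  IsGeneralPosition : List V → Set
  IsGeneralPosition X =
    ∀ {u v} (p : Walk u v) → IsShortest p →
    ∀ {x y z} → x ∈ X → y ∈ X → z ∈ X →
    ¬ (x ≡ y) → ¬ (y ≡ z) → ¬ (x ≡ z) →
    ¬ (x ∈ verts p × y ∈ verts p × z ∈ verts p)

  GpAtLeast : ℕ → Set
  GpAtLeast k = ∃[ X ] (Unique X × IsGeneralPosition X × k ≤ length X)

eqF : ∀ {k} → Fin k → Fin k → Bool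
eqF a b = ⌊ a ≟ b ⌋

-- (g,h)(g,h') for h ≠ h' (edges of K_n in each copy), and
-- (g,f(g'))(g',f(g)) for g ≠ g' (edges of K_m)
sierpAdjᵇ : ∀ {m n} → (Fin m → Fin n) → Fin m × Fin n → Fin m × Fin n → Bool
sierpAdjᵇ f (g , h) (g' , h') =
  (eqF g g' ∧ not (eqF h h'))
  ∨ (not (eqF g g') ∧ (eqF h (f g') ∧ eqF h' (f g)))

SierpAdj : ∀ {m n} → (Fin m → Fin n) → Fin m × Fin n → Fin m × Fin n → Set
SierpAdj f x y = T (sierpAdjᵇ f x y)

sierpVertices : ∀ m n → List (Fin m × Fin n)
sierpVertices m n = cartesianProduct (allFin m) (allFin n)

sierpDeg : ∀ {m n} → (Fin m → Fin n) → Fin m × Fin n → ℕ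
sierpDeg {m} {n} f x = length (filterᵇ (sierpAdjᵇ f x) (sierpVertices m n))

sierpV : ∀ {m n} → (Fin m → Fin n) → ℕ → ℕ
sierpV {m} {n} f k = length (filterᵇ (λ x → sierpDeg f x ≡ᵇ k) (sierpVertices m n))

-- In K_m ⊗_f K_n the vertex (g , h) is adjacent to the other n − 1 vertices of copy g and, by a
-- bridge edge, to (g′ , f g) for every g′ ≠ g with f g′ = h.
-- (i) So the vertices of degree n − 1 are those without bridge edges. Their neighbourhoods are
-- cliques, hence none of them is an inner vertex of a shortest path and together they are in
-- general position. In copy g only the at most m − 1 values f g′ (g′ ≠ g) carry bridges, which
-- leaves at least n − m + 1 such vertices in every copy.
-- (ii) Two sets are in general position: the extreme vertices (g , f g), and, for copies g₁ ≠ g₂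
-- with f g₁ ≠ f g₂ (or f constant), the 2(n − 1) vertices of these two copies other than the
-- bridge ends (g₁ , f g₂) and (g₂ , f g₁). Two members a, c of such a set are adjacent or joined
-- by a path of length 3 through a bridge, and in the second case every other member lies at
-- distance at least 3 from a or from c, so it is never on a shortest a–c path.

module Submission where

open import Defs
open import Data.Nat using (ℕ; zero; suc; _≤_; _<_; _+_; _*_; _∸_; _⊔_; z≤n; s≤s; _≡ᵇ_)
open import Data.Nat.Properties
  using (≤-refl; ≤-reflexive; ≤-trans; ≤-antisym; <⇒≢; <⇒≱; n≤1+n; n<1+n; m≤n⇒m≤1+n; m<m+n; m<n+m;
         +-comm; +-suc; +-identityʳ; +-mono-≤; +-monoʳ-≤; +-mono-≤-<; +-monoˡ-<; +-cancelˡ-≤; +-cancelʳ-≤;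
         +-cancelˡ-≡; *-comm; *-identityˡ; *-identityʳ; +-∸-assoc; m+n∸m≡n; ∸-monoʳ-≤; ⊔-sel;
         ≡ᵇ⇒≡; ≡⇒≡ᵇ; module ≤-Reasoning)
open import Data.Fin using (Fin; zero; suc; _≟_)
open import Data.Fin.Properties using (any?)
open import Data.Bool using (Bool; true; false; not; _∧_; _∨_; T)
open import Data.Bool.Properties using (∧-assoc; T-∧; T-∨)
open import Data.Product using (_×_; _,_; proj₁; proj₂; Σ-syntax)
open import Data.Sum using (_⊎_; inj₁; inj₂; [_,_])
import Data.Sum as Sum
open import Data.Empty using (⊥; ⊥-elim)
open import Data.List using (List; []; _∷_; _++_; map; length; filterᵇ; cartesianProduct; allFin)
open import Data.List.Properties
  using (length-map; length-++; length-tabulate; filter-++; filter-≐; filter-none; filter-some)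
open import Data.List.Membership.Propositional using (_∈_; lose)
open import Data.List.Membership.Propositional.Properties
  using (∈-allFin; ∈-map⁺; ∈-map⁻; ∈-filter⁺; ∈-filter⁻; ∈-++⁻)
open import Data.List.Relation.Unary.Any using (here; there)
open import Data.List.Relation.Unary.All using (All)
import Data.List.Relation.Unary.All as All
open import Data.List.Relation.Unary.Unique.Propositional using (Unique; []; _∷_)
open import Data.List.Relation.Unary.Unique.Propositional.Properties
  using (allFin⁺; map⁺; filter⁺; ++⁺; cartesianProduct⁺)
open import Function using (_∘_; id)
open import Function.Bundles using (Equivalence)
open import Relation.Nullary using (¬_; yes; no)
open import Relation.Nullary.Decidable
  using (T?; ¬?; ⌊_⌋; toWitness; fromWitness; toWitnessFalse; fromWitnessFalse; decidable-stable)
open import Relation.Binary.Definitions using (DecidableEquality)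
open import Relation.Binary.PropositionalEquality
  using (_≡_; _≢_; refl; sym; trans; cong; cong₂; subst; subst₂; ≢-sym; module ≡-Reasoning)

module WalkProperties {V : Set} (E : V → V → Set) where

  private
    variable
      a b c u v w x y z : V

  infixr 5 _++ʷ_

  _++ʷ_ : Walk E u v → Walk E v w → Walk E u w
  []      ++ʷ q = q
  (e ∷ p) ++ʷ q = e ∷ (p ++ʷ q)

  len-++ʷ : (p : Walk E u v) (q : Walk E v w) → len E (p ++ʷ q) ≡ len E p + len E q
  len-++ʷ []      q = refl
  len-++ʷ (e ∷ p) q = cong suc (len-++ʷ p q)

  ++ʷ-assoc : (p : Walk E u v) (q : Walk E v w) (r : Walk E w x) →
              (p ++ʷ q) ++ʷ r ≡ p ++ʷ (q ++ʷ r)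
  ++ʷ-assoc []      q r = refl
  ++ʷ-assoc (e ∷ p) q r = cong (e ∷_) (++ʷ-assoc p q r)

  start∈verts : (p : Walk E u v) → u ∈ verts E p
  start∈verts []      = here refl
  start∈verts (e ∷ p) = here refl

  end∈verts : (p : Walk E u v) → v ∈ verts E p
  end∈verts []      = here refl
  end∈verts (e ∷ p) = there (end∈verts p)

  ∈-verts-++ʷ⁻ : (p : Walk E u v) {q : Walk E v w} →
                 x ∈ verts E (p ++ʷ q) → x ∈ verts E p ⊎ x ∈ verts E q
  ∈-verts-++ʷ⁻ []      x∈q         = inj₂ x∈q
  ∈-verts-++ʷ⁻ (e ∷ p) (here refl) = inj₁ (here refl)
  ∈-verts-++ʷ⁻ (e ∷ p) (there x∈)  with ∈-verts-++ʷ⁻ p x∈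
  ... | inj₁ x∈p = inj₁ (there x∈p)
  ... | inj₂ x∈q = inj₂ x∈q

  split : (p : Walk E u v) → x ∈ verts E p →
          Σ[ p₁ ∈ Walk E u x ] Σ[ p₂ ∈ Walk E x v ] p₁ ++ʷ p₂ ≡ p
  split []      (here refl) = [] , [] , refl
  split (e ∷ p) (here refl) = [] , e ∷ p , refl
  split (e ∷ p) (there x∈p) with split p x∈p
  ... | p₁ , p₂ , p₁++p₂≡p = e ∷ p₁ , p₂ , cong (e ∷_) p₁++p₂≡p

  isShortest-++ʷˡ : (p : Walk E u v) (q : Walk E v w) → IsShortest E (p ++ʷ q) → IsShortest E p
  isShortest-++ʷˡ p q shortest p′ = +-cancelʳ-≤ (len E q) _ _
    (subst₂ _≤_ (len-++ʷ p q) (len-++ʷ p′ q) (shortest (p′ ++ʷ q)))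

  isShortest-++ʷʳ : (p : Walk E u v) (q : Walk E v w) → IsShortest E (p ++ʷ q) → IsShortest E q
  isShortest-++ʷʳ p q shortest q′ = +-cancelˡ-≤ (len E p) _ _
    (subst₂ _≤_ (len-++ʷ p q) (len-++ʷ p q′) (shortest (p ++ʷ q′)))

  Between : V → V → V → Set
  Between x y z = Σ[ p ∈ Walk E x y ] Σ[ q ∈ Walk E y z ] IsShortest E (p ++ʷ q)

  ∈-shortest⇒Between : (p : Walk E u v) → IsShortest E p → y ∈ verts E p → Between u y v
  ∈-shortest⇒Between p shortest y∈p with split p y∈p
  ... | p₁ , p₂ , refl = p₁ , p₂ , shortest

  ++ʷ-shortest⇒Between : (p : Walk E u y) (q : Walk E y v) → IsShortest E (p ++ʷ q) →
                         x ∈ verts E p → z ∈ verts E q → Between x y z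
  ++ʷ-shortest⇒Between p q shortest x∈p z∈q
    with p₁ , p₂ , refl ← split p x∈p | q₁ , q₂ , refl ← split q z∈q =
    p₂ , q₁ , isShortest-++ʷˡ (p₂ ++ʷ q₁) q₂ (isShortest-++ʷʳ p₁ ((p₂ ++ʷ q₁) ++ʷ q₂)
                (subst (IsShortest E) reassociate shortest))
    where
    reassociate : (p₁ ++ʷ p₂) ++ʷ (q₁ ++ʷ q₂) ≡ p₁ ++ʷ ((p₂ ++ʷ q₁) ++ʷ q₂)
    reassociate = trans (++ʷ-assoc p₁ p₂ (q₁ ++ʷ q₂)) (cong (p₁ ++ʷ_) (sym (++ʷ-assoc p₂ q₁ q₂)))

  two∈shortest⇒Between-end : (p : Walk E u y) → IsShortest E p → x ∈ verts E p → z ∈ verts E p →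
                              Between z x y ⊎ Between x z y
  two∈shortest⇒Between-end p shortest x∈p z∈p with p₁ , p₂ , refl ← split p x∈p
    with ∈-verts-++ʷ⁻ p₁ z∈p
  ... | inj₁ z∈p₁ = inj₁ (++ʷ-shortest⇒Between p₁ p₂ shortest z∈p₁ (end∈verts p₂))
  ... | inj₂ z∈p₂ = inj₂ (∈-shortest⇒Between p₂ (isShortest-++ʷʳ p₁ p₂ shortest) z∈p₂)

  two∈shortest⇒Between-start : (p : Walk E y v) → IsShortest E p → x ∈ verts E p → z ∈ verts E p →
                                Between y z x ⊎ Between y x z
  two∈shortest⇒Between-start p shortest x∈p z∈p with p₁ , p₂ , refl ← split p x∈p
    with ∈-verts-++ʷ⁻ p₁ z∈p
  ... | inj₁ z∈p₁ = inj₁ (∈-shortest⇒Between p₁ (isShortest-++ʷˡ p₁ p₂ shortest) z∈p₁)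
  ... | inj₂ z∈p₂ = inj₂ (++ʷ-shortest⇒Between p₁ p₂ shortest (start∈verts p₁) z∈p₂)

  ¬Between⇒generalPosition : (X : List V) →
    (∀ {a b c} → a ∈ X → b ∈ X → c ∈ X → a ≢ b → b ≢ c → a ≢ c → ¬ Between a b c) →
    IsGeneralPosition E X
  ¬Between⇒generalPosition X ¬between p shortest x∈X y∈X z∈X x≢y y≢z x≢z (x∈p , y∈p , z∈p)
    with p₁ , p₂ , refl ← split p y∈p
    with ∈-verts-++ʷ⁻ p₁ x∈p | ∈-verts-++ʷ⁻ p₁ z∈p
  ... | inj₁ x∈p₁ | inj₂ z∈p₂ =
    ¬between x∈X y∈X z∈X x≢y y≢z x≢z (++ʷ-shortest⇒Between p₁ p₂ shortest x∈p₁ z∈p₂)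
  ... | inj₂ x∈p₂ | inj₁ z∈p₁ =
    ¬between z∈X y∈X x∈X (≢-sym y≢z) (≢-sym x≢y) (≢-sym x≢z) (++ʷ-shortest⇒Between p₁ p₂ shortest z∈p₁ x∈p₂)
  ... | inj₁ x∈p₁ | inj₁ z∈p₁ =
    [ ¬between z∈X x∈X y∈X (≢-sym x≢z) x≢y (≢-sym y≢z) , ¬between x∈X z∈X y∈X x≢z (≢-sym y≢z) x≢y ]
      (two∈shortest⇒Between-end p₁ (isShortest-++ʷˡ p₁ p₂ shortest) x∈p₁ z∈p₁)
  ... | inj₂ x∈p₂ | inj₂ z∈p₂ =
    [ ¬between y∈X z∈X x∈X y≢z (≢-sym x≢z) (≢-sym x≢y) , ¬between y∈X x∈X z∈X (≢-sym x≢y) x≢z y≢z ]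
      (two∈shortest⇒Between-start p₂ (isShortest-++ʷʳ p₁ p₂ shortest) x∈p₂ z∈p₂)

  shortcut⇒¬Between : ((p : Walk E a b) (q : Walk E b c) → Σ[ r ∈ Walk E a c ] len E r < len E p + len E q) →
                      ¬ Between a b c
  shortcut⇒¬Between shortcut (p , q , shortest) with shortcut p q
  ... | r , r<p+q = <⇒≱ r<p+q (subst (_≤ len E r) (len-++ʷ p q) (shortest r))

  1≤len : a ≢ b → (p : Walk E a b) → 1 ≤ len E p
  1≤len a≢b []      = ⊥-elim (a≢b refl)
  1≤len a≢b (e ∷ p) = s≤s z≤n

  3≤len : a ≢ c → ¬ E a c → (∀ {b} → E a b → E b c → ⊥) → (p : Walk E a c) → 3 ≤ len E p
  3≤len a≢c ¬ac ¬abc []                = ⊥-elim (a≢c refl)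
  3≤len a≢c ¬ac ¬abc (e ∷ [])          = ⊥-elim (¬ac e)
  3≤len a≢c ¬ac ¬abc (e ∷ e′ ∷ [])     = ⊥-elim (¬abc e e′)
  3≤len a≢c ¬ac ¬abc (e ∷ e′ ∷ e″ ∷ p) = s≤s (s≤s (s≤s z≤n))

  side-shortcut⇒¬Between : (r : Walk E a c) → a ≢ b → b ≢ c →
    ((p : Walk E a b) → len E r ≤ len E p) ⊎ ((q : Walk E b c) → len E r ≤ len E q) →
    ¬ Between a b c
  side-shortcut⇒¬Between r a≢b b≢c (inj₁ r≤p) = shortcut⇒¬Between λ p q →
    r , ≤-trans (s≤s (r≤p p)) (m<m+n (len E p) (1≤len b≢c q))
  side-shortcut⇒¬Between r a≢b b≢c (inj₂ r≤q) = shortcut⇒¬Between λ p q →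
    r , ≤-trans (s≤s (r≤q q)) (m<n+m (len E q) (1≤len a≢b p))

  unsnoc : E u w → (p : Walk E w v) → Σ[ t ∈ V ] Σ[ p′ ∈ Walk E u t ] E t v × len E p′ ≡ len E p
  unsnoc e []       = _ , [] , e , refl
  unsnoc e (e′ ∷ p) with unsnoc e′ p
  ... | t , p′ , eₜ , len-p′ = t , e ∷ p′ , eₜ , cong suc len-p′

  IsSimplicial : V → Set
  IsSimplicial b = ∀ {u w} → E u b → E b w → u ≡ w ⊎ E u w

  simplicial⇒¬Between : IsSimplicial b → a ≢ b → b ≢ c → ¬ Between a b c
  simplicial⇒¬Between {b} {a} {c} simplicial a≢b b≢c = shortcut⇒¬Between shortcut
    where
    open ≤-Reasoning
    shortcut : (p : Walk E a b) (q : Walk E b c) → Σ[ r ∈ Walk E a c ] len E r < len E p + len E q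
    shortcut []      _       = ⊥-elim (a≢b refl)
    shortcut _       []      = ⊥-elim (b≢c refl)
    shortcut (e ∷ p) (e′ ∷ q) with unsnoc e p
    ... | t , p′ , eₜ , len-p′ with simplicial eₜ e′
    ...   | inj₁ refl = p′ ++ʷ q , (begin-strict
      len E (p′ ++ʷ q)            ≡⟨ len-++ʷ p′ q ⟩
      len E p′ + len E q          ≡⟨ cong (_+ len E q) len-p′ ⟩
      len E p + len E q           <⟨ +-mono-≤-< (n≤1+n (len E p)) (n<1+n (len E q)) ⟩
      suc (len E p) + suc (len E q) ∎)
    ...   | inj₂ e″   = p′ ++ʷ e″ ∷ q , (begin-strict
      len E (p′ ++ʷ e″ ∷ q)       ≡⟨ len-++ʷ p′ (e″ ∷ q) ⟩
      len E p′ + suc (len E q)    ≡⟨ cong (_+ suc (len E q)) len-p′ ⟩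
      len E p + suc (len E q)     <⟨ +-monoˡ-< (suc (len E q)) (n<1+n (len E p)) ⟩
      suc (len E p) + suc (len E q) ∎)

  simplicial⇒generalPosition : (X : List V) → (∀ {x} → x ∈ X → IsSimplicial x) → IsGeneralPosition E X
  simplicial⇒generalPosition X simplicial = ¬Between⇒generalPosition X λ _ b∈X _ a≢b b≢c _ →
    simplicial⇒¬Between (simplicial b∈X) a≢b b≢c

  gpAtLeast-⊔ : ∀ {k l} → GpAtLeast E k → GpAtLeast E l → GpAtLeast E (k ⊔ l)
  gpAtLeast-⊔ {k} {l} gp-k gp-l with ⊔-sel k l
  ... | inj₁ k⊔l≡k = subst (GpAtLeast E) (sym k⊔l≡k) gp-k
  ... | inj₂ k⊔l≡l = subst (GpAtLeast E) (sym k⊔l≡l) gp-l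

private
  variable
    A B : Set

count : (A → Bool) → List A → ℕ
count p xs = length (filterᵇ p xs)

count-++ : (p : A → Bool) (xs ys : List A) → count p (xs ++ ys) ≡ count p xs + count p ys
count-++ p xs ys = trans (cong length (filter-++ (T? ∘ p) xs ys)) (length-++ (filterᵇ p xs))

count-cong : {p q : A → Bool} → (∀ x → p x ≡ q x) → ∀ xs → count p xs ≡ count q xs
count-cong {p = p} {q} p≗q xs =
  cong length (filter-≐ (T? ∘ p) (T? ∘ q) ((λ {x} → subst T (p≗q x)) , (λ {x} → subst T (sym (p≗q x)))) xs)

count-none : {p : A → Bool} {xs : List A} → All (λ x → ¬ T (p x)) xs → count p xs ≡ 0
count-none {p = p} ¬p = cong length (filter-none (T? ∘ p) ¬p)

count-some : {p : A → Bool} {x : A} {xs : List A} → x ∈ xs → T (p x) → 0 < count p xs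
count-some {p = p} x∈xs px = filter-some (T? ∘ p) (lose x∈xs px)

count-mono : {p q : A → Bool} → (∀ x → T (p x) → T (q x)) → ∀ xs → count p xs ≤ count q xs
count-mono             p⇒q []       = z≤n
count-mono {p = p} {q} p⇒q (x ∷ xs) with p x | q x | p⇒q x
... | true  | true  | _   = s≤s (count-mono p⇒q xs)
... | true  | false | p⇒q = ⊥-elim (p⇒q _)
... | false | true  | _   = m≤n⇒m≤1+n (count-mono p⇒q xs)
... | false | false | _   = count-mono p⇒q xs

count-∨ : {p q : A → Bool} → (∀ x → T (p x) → T (q x) → ⊥) →
          ∀ xs → count (λ x → p x ∨ q x) xs ≡ count p xs + count q xs
count-∨             disjoint []       = refl
count-∨ {p = p} {q} disjoint (x ∷ xs) with p x | q x | disjoint x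
... | true  | true  | disjoint = ⊥-elim (disjoint _ _)
... | true  | false | _ = cong suc (count-∨ disjoint xs)
... | false | true  | _ = trans (cong suc (count-∨ disjoint xs)) (sym (+-suc _ _))
... | false | false | _ = count-∨ disjoint xs

count-∨-≤ : (p q : A → Bool) → ∀ xs → count (λ x → p x ∨ q x) xs ≤ count p xs + count q xs
count-∨-≤ p q []       = z≤n
count-∨-≤ p q (x ∷ xs) with ih ← count-∨-≤ p q xs | p x | q x
... | true  | true  = s≤s (≤-trans ih (+-monoʳ-≤ (count p xs) (n≤1+n _)))
... | true  | false = s≤s ih
... | false | true  = ≤-trans (s≤s ih) (≤-reflexive (sym (+-suc _ _)))
... | false | false = ih

count-complement : (p : A → Bool) (xs : List A) → count p xs + count (not ∘ p) xs ≡ length xs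
count-complement p []       = refl
count-complement p (x ∷ xs) with p x
... | true  = cong suc (count-complement p xs)
... | false = trans (+-suc _ _) (cong suc (count-complement p xs))

count-≤1 : {p : A → Bool} {c : A} {xs : List A} → Unique xs → (∀ {x} → T (p x) → x ≡ c) →
           count p xs ≤ 1
count-≤1                    []                 p⇒≡c = z≤n
count-≤1 {p = p} {c} {x ∷ xs} (x∉xs ∷ unique) p⇒≡c with p x in px
... | true  = s≤s (≤-reflexive (count-none (All.map ¬p x∉xs)))
  where
  ¬p : ∀ {y} → x ≢ y → ¬ T (p y)
  ¬p x≢y py = x≢y (trans (p⇒≡c (subst T (sym px) _)) (sym (p⇒≡c py)))
... | false = count-≤1 unique p⇒≡c

count-single : {p : A → Bool} {c : A} {xs : List A} → Unique xs → c ∈ xs → T (p c) →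
               (∀ {x} → T (p x) → x ≡ c) → count p xs ≡ 1
count-single unique c∈xs pc p⇒≡c = ≤-antisym (count-≤1 unique p⇒≡c) (count-some c∈xs pc)

count-map : (p : B → Bool) (F : A → B) (xs : List A) → count p (map F xs) ≡ count (p ∘ F) xs
count-map p F []       = refl
count-map p F (x ∷ xs) with p (F x)
... | true  = cong suc (count-map p F xs)
... | false = count-map p F xs

count-cartesianProduct-∷ : (p : A × B → Bool) (x : A) (xs : List A) (ys : List B) →
  count p (cartesianProduct (x ∷ xs) ys) ≡ count (λ y → p (x , y)) ys + count p (cartesianProduct xs ys)
count-cartesianProduct-∷ p x xs ys =
  trans (count-++ p (map (x ,_) ys) _) (cong (_+ _) (count-map p (x ,_) ys))

count-× : (p : A → Bool) (q : B → Bool) (xs : List A) (ys : List B) →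
          count (λ (x , y) → p x ∧ q y) (cartesianProduct xs ys) ≡ count p xs * count q ys
count-× p q []       ys = refl
count-× p q (x ∷ xs) ys with p x in px
... | true  = trans (count-cartesianProduct-∷ _ x xs ys)
                (cong₂ _+_ (count-cong (λ y → cong (_∧ q y) px) ys) (count-× p q xs ys))
... | false = trans (count-cartesianProduct-∷ _ x xs ys)
                (cong₂ _+_ (trans (count-cong (λ y → cong (_∧ q y) px) ys)
                                  (count-none (All.universal (λ _ ()) ys)))
                           (count-× p q xs ys))

count-cartesianProduct-≥ : (p : A × B → Bool) {k : ℕ} (xs : List A) (ys : List B) →
  (∀ x → k ≤ count (λ y → p (x , y)) ys) → length xs * k ≤ count p (cartesianProduct xs ys)
count-cartesianProduct-≥ p []       ys k≤ = z≤n
count-cartesianProduct-≥ p (x ∷ xs) ys k≤ =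
  ≤-trans (+-mono-≤ (k≤ x) (count-cartesianProduct-≥ p xs ys k≤))
          (≤-reflexive (sym (count-cartesianProduct-∷ p x xs ys)))

module _ {A : Set} (_≟_ : DecidableEquality A) where

  open import Data.List.Membership.DecPropositional _≟_ using (_∈?_)

  count-∈-≤ : {xs : List A} → Unique xs → (ys : List A) → count (λ x → ⌊ x ∈? ys ⌋) xs ≤ length ys
  count-∈-≤ {xs} unique [] = ≤-reflexive (count-none {p = λ x → ⌊ x ∈? [] ⌋} (All.universal (λ _ ()) xs))
  count-∈-≤ {xs} unique (y ∷ ys) = begin
    count (λ x → ⌊ x ∈? y ∷ ys ⌋) xs              ≤⟨ count-mono ∈y∷ys⇒ xs ⟩
    count (λ x → ⌊ x ≟ y ⌋ ∨ ⌊ x ∈? ys ⌋) xs       ≤⟨ count-∨-≤ _ _ xs ⟩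
    count (λ x → ⌊ x ≟ y ⌋) xs + count (λ x → ⌊ x ∈? ys ⌋) xs
      ≤⟨ +-mono-≤ (count-≤1 unique toWitness) (count-∈-≤ unique ys) ⟩
    1 + length ys                                 ∎
    where
    open ≤-Reasoning
    ∈y∷ys⇒ : ∀ x → T ⌊ x ∈? y ∷ ys ⌋ → T (⌊ x ≟ y ⌋ ∨ ⌊ x ∈? ys ⌋)
    ∈y∷ys⇒ x t with toWitness t
    ... | here x≡y   = Equivalence.from (T-∨ {⌊ x ≟ y ⌋}) (inj₁ (fromWitness x≡y))
    ... | there x∈ys = Equivalence.from (T-∨ {⌊ x ≟ y ⌋}) (inj₂ (fromWitness {a? = x ∈? ys} x∈ys))

  count-∉-≥ : {xs : List A} → Unique xs → (ys : List A) →
              length xs ∸ length ys ≤ count (λ x → not ⌊ x ∈? ys ⌋) xs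
  count-∉-≥ {xs} unique ys = begin
    length xs ∸ length ys   ≤⟨ ∸-monoʳ-≤ (length xs) (count-∈-≤ unique ys) ⟩
    length xs ∸ count∈      ≡⟨ cong (_∸ count∈) (sym (count-complement _ xs)) ⟩
    count∈ + count∉ ∸ count∈ ≡⟨ m+n∸m≡n count∈ count∉ ⟩
    count∉                  ∎
    where
    open ≤-Reasoning
    count∈ count∉ : ℕ
    count∈ = count (λ x → ⌊ x ∈? ys ⌋) xs
    count∉ = count (λ x → not ⌊ x ∈? ys ⌋) xs

length-allFin : ∀ k → length (allFin k) ≡ k
length-allFin k = length-tabulate id

count-allFin-≟ : ∀ {k} (c : Fin k) → count (eqF c) (allFin k) ≡ 1
count-allFin-≟ {k} c = count-single (allFin⁺ k) (∈-allFin c) (fromWitness refl) (sym ∘ toWitness)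

count-allFin-≟ʳ : ∀ {k} (c : Fin k) → count (λ x → eqF x c) (allFin k) ≡ 1
count-allFin-≟ʳ {k} c = count-single (allFin⁺ k) (∈-allFin c) (fromWitness refl) toWitness

count-allFin-≢ : ∀ {k} (c : Fin k) → count (λ x → not (eqF c x)) (allFin k) ≡ k ∸ 1
count-allFin-≢ {k} c = begin
  count≢                                  ≡⟨ sym (m+n∸m≡n 1 count≢) ⟩
  1 + count≢ ∸ 1                          ≡⟨ cong (λ t → t + count≢ ∸ 1) (sym (count-allFin-≟ c)) ⟩
  count (eqF c) (allFin k) + count≢ ∸ 1   ≡⟨ cong (_∸ 1) (count-complement (eqF c) (allFin k)) ⟩
  length (allFin k) ∸ 1                   ≡⟨ cong (_∸ 1) (length-allFin k) ⟩
  k ∸ 1                                   ∎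
  where
  open ≡-Reasoning
  count≢ : ℕ
  count≢ = count (λ x → not (eqF c x)) (allFin k)

n∸m+1≡n∸[m∸1] : ∀ {m n} → 1 ≤ m → m ≤ n → n ∸ m + 1 ≡ n ∸ (m ∸ 1)
n∸m+1≡n∸[m∸1] {suc k} {n} _ m≤n = trans (+-comm (n ∸ suc k) 1) (sym (+-∸-assoc 1 m≤n))

module Sierpiński {m n : ℕ} (f : Fin m → Fin n) where

  V : Set
  V = Fin m × Fin n

  open WalkProperties (SierpAdj f)
  open import Data.List.Membership.DecPropositional (_≟_ {n}) using (_∈?_)

  -- bridge carries equations rather than the indices (g , f g′) (g′ , f g), so that matching on
  -- two consecutive edges never has to unify f g with f g′.
  data Adj : V → V → Set where
    inCopy : ∀ {g h h′} → h ≢ h′ → Adj (g , h) (g , h′)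
    bridge : ∀ {g g′ h h′} → g ≢ g′ → h ≡ f g′ → h′ ≡ f g → Adj (g , h) (g′ , h′)

  sierpAdj⇒Adj : ∀ {x y} → SierpAdj f x y → Adj x y
  sierpAdj⇒Adj {g , h} {g′ , h′} e with g ≟ g′ | h ≟ h′ | h ≟ f g′ | h′ ≟ f g
  ... | yes refl   | no h≢h′ | _        | _         = inCopy h≢h′
  ... | no g≢g′    | _       | yes h≡   | yes h′≡   = bridge g≢g′ h≡ h′≡
  ... | yes refl   | yes _   | _        | _         = ⊥-elim e
  ... | no _       | _       | no _     | _         = ⊥-elim e
  ... | no _       | _       | yes _    | no _      = ⊥-elim e

  Adj⇒sierpAdj : ∀ {x y} → Adj x y → SierpAdj f x y
  Adj⇒sierpAdj (inCopy {g} {h} {h′} h≢h′) with g ≟ g | h ≟ h′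
  ... | yes _    | no _     = _
  ... | yes _    | yes h≡h′ = ⊥-elim (h≢h′ h≡h′)
  ... | no g≢g   | _        = ⊥-elim (g≢g refl)
  Adj⇒sierpAdj (bridge {g} {g′} {h} {h′} g≢g′ h≡ h′≡) with g ≟ g′ | h ≟ f g′ | h′ ≟ f g
  ... | no _     | yes _ | yes _  = _
  ... | yes g≡g′ | _     | _      = ⊥-elim (g≢g′ g≡g′)
  ... | no _     | no h≢ | _      = ⊥-elim (h≢ h≡)
  ... | no _     | yes _ | no h′≢ = ⊥-elim (h′≢ h′≡)

  private
    variable
      g g′ gx gy g₁ g₂ : Fin m
      h h′ hx hy : Fin n
      a b c : V

  Constant : Set
  Constant = ∀ c c′ → f c ≡ f c′

  viaBridge : g ≢ g′ → h ≢ f g′ → h′ ≢ f g → Walk (SierpAdj f) (g , h) (g′ , h′)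
  viaBridge {g} {g′} {h} {h′} g≢g′ h≢ h′≢ =
    Adj⇒sierpAdj {g , h} {g , f g′} (inCopy h≢) ∷
    Adj⇒sierpAdj {g , f g′} {g′ , f g} (bridge g≢g′ refl refl) ∷
    Adj⇒sierpAdj {g′ , f g} {g′ , h′} (inCopy (≢-sym h′≢)) ∷ []

  ¬Adj-across : gx ≢ gy → hx ≢ f gy → ¬ Adj (gx , hx) (gy , hy)
  ¬Adj-across gx≢gy hx≢ (inCopy _)       = gx≢gy refl
  ¬Adj-across gx≢gy hx≢ (bridge _ hx≡ _) = hx≢ hx≡

  -- A path of length 2 between the copies gx ≢ gy runs (gx , f c) (c , f gx) (gy , f c) through a
  -- third copy c; it needs f gx ≡ f gy, and for constant f its start hx ≡ f c contradicts hx ≢ f gy.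
  ¬commonNeighbour-across : gx ≢ gy → hx ≢ f gy → hy ≢ f gx → f gx ≢ f gy ⊎ Constant →
                            Adj (gx , hx) b → Adj b (gy , hy) → ⊥
  ¬commonNeighbour-across gx≢gy hx≢ hy≢ _ (inCopy _) (inCopy _)          = gx≢gy refl
  ¬commonNeighbour-across gx≢gy hx≢ hy≢ _ (inCopy _) (bridge _ _ hy≡)    = hy≢ hy≡
  ¬commonNeighbour-across gx≢gy hx≢ hy≢ _ (bridge _ hx≡ _) (inCopy _)    = hx≢ hx≡
  ¬commonNeighbour-across gx≢gy hx≢ hy≢ (inj₁ fx≢fy) (bridge _ _ k≡fx) (bridge _ k≡fy _) =
    fx≢fy (trans (sym k≡fx) k≡fy)
  ¬commonNeighbour-across {gy = gy} gx≢gy hx≢ hy≢ (inj₂ constant) (bridge {g′ = c} _ hx≡ _) (bridge _ _ _) =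
    hx≢ (trans hx≡ (constant c gy))

  3≤len-across : gx ≢ gy → hx ≢ f gy → hy ≢ f gx → f gx ≢ f gy ⊎ Constant →
                 (p : Walk (SierpAdj f) (gx , hx) (gy , hy)) → 3 ≤ len (SierpAdj f) p
  3≤len-across gx≢gy hx≢ hy≢ separated = 3≤len (gx≢gy ∘ cong proj₁) (¬Adj-across gx≢gy hx≢ ∘ sierpAdj⇒Adj)
    λ e e′ → ¬commonNeighbour-across gx≢gy hx≢ hy≢ separated (sierpAdj⇒Adj e) (sierpAdj⇒Adj e′)

  Bridgeless : Fin m → Fin n → Set
  Bridgeless g h = ∀ {g′} → g ≢ g′ → f g′ ≢ h

  bridgeless-neighbours : Bridgeless g h → Adj a (g , h) → Adj (g , h) b → a ≡ b ⊎ Adj a b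
  bridgeless-neighbours bridgeless (bridge a≢g _ h≡fa) _ = ⊥-elim (bridgeless (a≢g ∘ sym) (sym h≡fa))
  bridgeless-neighbours bridgeless (inCopy _) (bridge g≢b h≡fb _) = ⊥-elim (bridgeless g≢b (sym h≡fb))
  bridgeless-neighbours bridgeless (inCopy {h = ha} _) (inCopy {h′ = hb} _) with ha ≟ hb
  ... | yes refl  = inj₁ refl
  ... | no ha≢hb  = inj₂ (inCopy ha≢hb)

  bridgeless⇒simplicial : Bridgeless g h → IsSimplicial (g , h)
  bridgeless⇒simplicial bridgeless ea eb =
    Sum.map₂ Adj⇒sierpAdj (bridgeless-neighbours bridgeless (sierpAdj⇒Adj ea) (sierpAdj⇒Adj eb))

  bridges : Fin m → Fin n → ℕ
  bridges g h = count (λ g′ → not (eqF g g′) ∧ eqF h (f g′)) (allFin m)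

  sierpDeg-≡ : ∀ g h → sierpDeg f (g , h) ≡ n ∸ 1 + bridges g h
  sierpDeg-≡ g h = begin
    sierpDeg f (g , h)
      ≡⟨ count-∨ {p = inCopyᵇ} {q = bridgeᵇ} (λ (g′ , _) → excluded (eqF g g′)) (sierpVertices m n) ⟩
    count inCopyᵇ (sierpVertices m n) + count bridgeᵇ (sierpVertices m n)
      ≡⟨ cong₂ _+_ (count-× (eqF g) (λ h′ → not (eqF h h′)) (allFin m) (allFin n))
                   (trans (count-cong reassociate (sierpVertices m n))
                          (count-× (λ g′ → not (eqF g g′) ∧ eqF h (f g′)) (λ h′ → eqF h′ (f g))
                                   (allFin m) (allFin n))) ⟩
    count (eqF g) (allFin m) * count (λ h′ → not (eqF h h′)) (allFin n)
      + bridges g h * count (λ h′ → eqF h′ (f g)) (allFin n)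
      ≡⟨ cong₂ _+_ (cong₂ _*_ (count-allFin-≟ g) (count-allFin-≢ h))
                   (cong (bridges g h *_) (count-allFin-≟ʳ (f g))) ⟩
    1 * (n ∸ 1) + bridges g h * 1
      ≡⟨ cong₂ _+_ (*-identityˡ (n ∸ 1)) (*-identityʳ (bridges g h)) ⟩
    n ∸ 1 + bridges g h ∎
    where
    open ≡-Reasoning
    inCopyᵇ bridgeᵇ : V → Bool
    inCopyᵇ (g′ , h′) = eqF g g′ ∧ not (eqF h h′)
    bridgeᵇ (g′ , h′) = not (eqF g g′) ∧ (eqF h (f g′) ∧ eqF h′ (f g))
    excluded : ∀ b {c d} → T (b ∧ c) → T (not b ∧ d) → ⊥
    excluded true  _ ()
    excluded false ()
    reassociate : ∀ x → bridgeᵇ x ≡ (not (eqF g (proj₁ x)) ∧ eqF h (f (proj₁ x))) ∧ eqF (proj₂ x) (f g)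
    reassociate (g′ , h′) = sym (∧-assoc (not (eqF g g′)) (eqF h (f g′)) (eqF h′ (f g)))

  bridgeless⇒sierpDeg : Bridgeless g h → sierpDeg f (g , h) ≡ n ∸ 1
  bridgeless⇒sierpDeg {g} {h} bridgeless =
    trans (sierpDeg-≡ g h)
          (trans (cong (n ∸ 1 +_) (count-none (All.universal ¬bridge (allFin m)))) (+-identityʳ _))
    where
    ¬bridge : ∀ g′ → ¬ T (not (eqF g g′) ∧ eqF h (f g′))
    ¬bridge g′ t with Equivalence.to (T-∧ {not (eqF g g′)}) t
    ... | g≢g′ , h≡fg′ = bridgeless (toWitnessFalse g≢g′) (sym (toWitness h≡fg′))

  sierpDeg⇒bridgeless : sierpDeg f (g , h) ≡ n ∸ 1 → Bridgeless g h
  sierpDeg⇒bridgeless {g} {h} deg {g′} g≢g′ fg′≡h =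
    <⇒≢ (count-some (∈-allFin g′) g′-bridge) (sym no-bridges)
    where
    no-bridges : bridges g h ≡ 0
    no-bridges = +-cancelˡ-≡ (n ∸ 1) _ _ (trans (sym (sierpDeg-≡ g h)) (trans deg (sym (+-identityʳ _))))
    g′-bridge : T (not (eqF g g′) ∧ eqF h (f g′))
    g′-bridge = Equivalence.from T-∧
      (fromWitnessFalse {a? = g ≟ g′} g≢g′ , fromWitness {a? = h ≟ f g′} (sym fg′≡h))

  degreeSet : List V
  degreeSet = filterᵇ (λ x → sierpDeg f x ≡ᵇ n ∸ 1) (sierpVertices m n)

  degreeSet-gp : GpAtLeast (SierpAdj f) (sierpV f (n ∸ 1))
  degreeSet-gp =
    degreeSet , filter⁺ (T? ∘ _) (cartesianProduct⁺ (allFin⁺ m) (allFin⁺ n)) ,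
    simplicial⇒generalPosition degreeSet simplicial , ≤-refl
    where
    simplicial : ∀ {x} → x ∈ degreeSet → IsSimplicial x
    simplicial x∈ = bridgeless⇒simplicial
      (sierpDeg⇒bridgeless (≡ᵇ⇒≡ _ _ (proj₂ (∈-filter⁻ (T? ∘ _) {xs = sierpVertices m n} x∈))))

  bridgeValues : Fin m → List (Fin n)
  bridgeValues g = map f (filterᵇ (λ g′ → not (eqF g g′)) (allFin m))

  length-bridgeValues : (g : Fin m) → length (bridgeValues g) ≡ m ∸ 1
  length-bridgeValues g =
    trans (length-map f (filterᵇ (λ g′ → not (eqF g g′)) (allFin m))) (count-allFin-≢ g)

  ∉bridgeValues⇒bridgeless : ¬ (h ∈ bridgeValues g) → Bridgeless g h
  ∉bridgeValues⇒bridgeless h∉ {g′} g≢g′ refl =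
    h∉ (∈-map⁺ f (∈-filter⁺ (T? ∘ _) (∈-allFin g′) (fromWitnessFalse g≢g′)))

  degreeSet-perCopy-≥ : (g : Fin m) → n ∸ (m ∸ 1) ≤ count (λ h → sierpDeg f (g , h) ≡ᵇ n ∸ 1) (allFin n)
  degreeSet-perCopy-≥ g = begin
    n ∸ (m ∸ 1)
      ≡⟨ cong₂ _∸_ (sym (length-allFin n)) (sym (length-bridgeValues g)) ⟩
    length (allFin n) ∸ length (bridgeValues g)
      ≤⟨ count-∉-≥ _≟_ (allFin⁺ n) (bridgeValues g) ⟩
    count (λ h → not ⌊ h ∈? bridgeValues g ⌋) (allFin n)
      ≤⟨ count-mono (λ h h∉ → ≡⇒≡ᵇ _ _ (bridgeless⇒sierpDeg (∉bridgeValues⇒bridgeless (toWitnessFalse h∉))))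
                    (allFin n) ⟩
    count (λ h → sierpDeg f (g , h) ≡ᵇ n ∸ 1) (allFin n) ∎
    where open ≤-Reasoning

  sierpV-≥ : 1 ≤ m → m ≤ n → (n ∸ m + 1) * m ≤ sierpV f (n ∸ 1)
  sierpV-≥ 1≤m m≤n = begin
    (n ∸ m + 1) * m                   ≡⟨ *-comm _ m ⟩
    m * (n ∸ m + 1)                   ≡⟨ cong₂ _*_ (sym (length-allFin m)) (n∸m+1≡n∸[m∸1] 1≤m m≤n) ⟩
    length (allFin m) * (n ∸ (m ∸ 1)) ≤⟨ count-cartesianProduct-≥ _ (allFin m) (allFin n) degreeSet-perCopy-≥ ⟩
    sierpV f (n ∸ 1)                  ∎
    where open ≤-Reasoning

  extreme : Fin m → V
  extreme g = g , f g

  3≤len-extreme : f gx ≢ f gy → (p : Walk (SierpAdj f) (extreme gx) (extreme gy)) → 3 ≤ len (SierpAdj f) p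
  3≤len-extreme fx≢fy = 3≤len-across (fx≢fy ∘ cong f) fx≢fy (≢-sym fx≢fy) (inj₁ fx≢fy)

  extreme-¬Between : extreme gx ≢ extreme g → extreme g ≢ extreme gy → extreme gx ≢ extreme gy →
                     ¬ Between (extreme gx) (extreme g) (extreme gy)
  extreme-¬Between {gx} {g} {gy} a≢b b≢c a≢c with f gx ≟ f gy | f gx ≟ f g
  ... | yes fx≡fy | _ =
    side-shortcut⇒¬Between (Adj⇒sierpAdj (bridge (a≢c ∘ cong extreme) fx≡fy (sym fx≡fy)) ∷ []) a≢b b≢c
      (inj₁ (1≤len a≢b))
  ... | no fx≢fy | no fx≢f =
    side-shortcut⇒¬Between (viaBridge (a≢c ∘ cong extreme) fx≢fy (≢-sym fx≢fy)) a≢b b≢c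
      (inj₁ (3≤len-extreme fx≢f))
  ... | no fx≢fy | yes fx≡f =
    side-shortcut⇒¬Between (viaBridge (a≢c ∘ cong extreme) fx≢fy (≢-sym fx≢fy)) a≢b b≢c
      (inj₂ (3≤len-extreme (fx≢fy ∘ trans fx≡f)))

  extremeVertices-gp : GpAtLeast (SierpAdj f) m
  extremeVertices-gp =
    extremeVertices , map⁺ (cong proj₁) (allFin⁺ m) ,
    ¬Between⇒generalPosition extremeVertices ¬between ,
    ≤-reflexive (sym (trans (length-map extreme (allFin m)) (length-allFin m)))
    where
    extremeVertices : List V
    extremeVertices = map extreme (allFin m)
    ¬between : a ∈ extremeVertices → b ∈ extremeVertices → c ∈ extremeVertices →
               a ≢ b → b ≢ c → a ≢ c → ¬ Between a b c
    ¬between a∈ b∈ c∈ with ∈-map⁻ extreme a∈ | ∈-map⁻ extreme b∈ | ∈-map⁻ extreme c∈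
    ... | _ , _ , refl | _ , _ , refl | _ , _ , refl = extreme-¬Between

  data InPair (g₁ g₂ : Fin m) : V → Set where
    left  : h ≢ f g₂ → InPair g₁ g₂ (g₁ , h)
    right : h ≢ f g₁ → InPair g₁ g₂ (g₂ , h)

  InPair-sym : InPair g₁ g₂ a → InPair g₂ g₁ a
  InPair-sym (left h≢)  = right h≢
  InPair-sym (right h≢) = left h≢

  sameCopy-¬Between : (g , h) ≢ b → b ≢ (g , h′) → (g , h) ≢ (g , h′) → ¬ Between (g , h) b (g , h′)
  sameCopy-¬Between {g} a≢b b≢c a≢c =
    side-shortcut⇒¬Between (Adj⇒sierpAdj (inCopy {g} (a≢c ∘ cong (g ,_))) ∷ []) a≢b b≢c (inj₁ (1≤len a≢b))

  across-¬Between : g₁ ≢ g₂ → f g₁ ≢ f g₂ ⊎ Constant → h ≢ f g₂ → h′ ≢ f g₁ → InPair g₁ g₂ b →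
                    (g₁ , h) ≢ b → b ≢ (g₂ , h′) → ¬ Between (g₁ , h) b (g₂ , h′)
  across-¬Between g₁≢g₂ separated h≢ h′≢ (left hb≢) a≢b b≢c =
    side-shortcut⇒¬Between (viaBridge g₁≢g₂ h≢ h′≢) a≢b b≢c (inj₂ (3≤len-across g₁≢g₂ hb≢ h′≢ separated))
  across-¬Between g₁≢g₂ separated h≢ h′≢ (right hb≢) a≢b b≢c =
    side-shortcut⇒¬Between (viaBridge g₁≢g₂ h≢ h′≢) a≢b b≢c (inj₁ (3≤len-across g₁≢g₂ h≢ hb≢ separated))

  pair-¬Between : g₁ ≢ g₂ → f g₁ ≢ f g₂ ⊎ Constant → InPair g₁ g₂ a → InPair g₁ g₂ b → InPair g₁ g₂ c →
                  a ≢ b → b ≢ c → a ≢ c → ¬ Between a b c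
  pair-¬Between _ _ (left _)  _ (left _)  = sameCopy-¬Between
  pair-¬Between _ _ (right _) _ (right _) = sameCopy-¬Between
  pair-¬Between g₁≢g₂ separated (left h≢) b∈ (right h′≢) a≢b b≢c _ =
    across-¬Between g₁≢g₂ separated h≢ h′≢ b∈ a≢b b≢c
  pair-¬Between g₁≢g₂ separated (right h≢) b∈ (left h′≢) a≢b b≢c _ =
    across-¬Between (≢-sym g₁≢g₂) (Sum.map₁ ≢-sym separated) h≢ h′≢ (InPair-sym b∈) a≢b b≢c

  copyExcept : Fin m → Fin n → List V
  copyExcept g h = map (g ,_) (filterᵇ (λ h′ → not (eqF h h′)) (allFin n))

  ∈-copyExcept⁻ : a ∈ copyExcept g h → Σ[ h′ ∈ Fin n ] h′ ≢ h × a ≡ (g , h′)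
  ∈-copyExcept⁻ {g = g} {h} a∈ with ∈-map⁻ (g ,_) a∈
  ... | h′ , h′∈ , refl =
    h′ , ≢-sym (toWitnessFalse (proj₂ (∈-filter⁻ (T? ∘ _) {xs = allFin n} h′∈))) , refl

  unique-copyExcept : (g : Fin m) (h : Fin n) → Unique (copyExcept g h)
  unique-copyExcept g h = map⁺ (cong proj₂) (filter⁺ (T? ∘ _) (allFin⁺ n))

  length-copyExcept : (g : Fin m) (h : Fin n) → length (copyExcept g h) ≡ n ∸ 1
  length-copyExcept g h =
    trans (length-map (g ,_) (filterᵇ (λ h′ → not (eqF h h′)) (allFin n))) (count-allFin-≢ h)

  pairSet : Fin m → Fin m → List V
  pairSet g₁ g₂ = copyExcept g₁ (f g₂) ++ copyExcept g₂ (f g₁)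

  ∈-pairSet⁻ : a ∈ pairSet g₁ g₂ → InPair g₁ g₂ a
  ∈-pairSet⁻ {g₁ = g₁} {g₂} a∈ with ∈-++⁻ (copyExcept g₁ (f g₂)) a∈
  ... | inj₁ a∈₁ with ∈-copyExcept⁻ a∈₁
  ...   | _ , h≢ , refl = left h≢
  ∈-pairSet⁻ {g₁ = g₁} {g₂} a∈ | inj₂ a∈₂ with ∈-copyExcept⁻ a∈₂
  ...   | _ , h≢ , refl = right h≢

  pairSet-gp : g₁ ≢ g₂ → f g₁ ≢ f g₂ ⊎ Constant → GpAtLeast (SierpAdj f) (2 * (n ∸ 1))
  pairSet-gp {g₁} {g₂} g₁≢g₂ separated =
    pairSet g₁ g₂ ,
    ++⁺ (unique-copyExcept g₁ (f g₂)) (unique-copyExcept g₂ (f g₁)) disjoint ,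
    ¬Between⇒generalPosition (pairSet g₁ g₂)
      (λ a∈ b∈ c∈ → pair-¬Between g₁≢g₂ separated (∈-pairSet⁻ a∈) (∈-pairSet⁻ b∈) (∈-pairSet⁻ c∈)) ,
    ≤-reflexive (sym length-pairSet)
    where
    disjoint : ∀ {a} → ¬ (a ∈ copyExcept g₁ (f g₂) × a ∈ copyExcept g₂ (f g₁))
    disjoint (a∈₁ , a∈₂) with ∈-copyExcept⁻ a∈₁ | ∈-copyExcept⁻ a∈₂
    ... | _ , _ , refl | _ , _ , g₁h≡g₂h′ = g₁≢g₂ (cong proj₁ g₁h≡g₂h′)
    length-pairSet : length (pairSet g₁ g₂) ≡ 2 * (n ∸ 1)
    length-pairSet = trans (length-++ (copyExcept g₁ (f g₂)))
      (cong₂ _+_ (length-copyExcept g₁ (f g₂)) (trans (length-copyExcept g₂ (f g₁)) (sym (+-identityʳ _))))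

  separatedPair : g ≢ g′ → Σ[ g₁ ∈ Fin m ] Σ[ g₂ ∈ Fin m ] g₁ ≢ g₂ × (f g₁ ≢ f g₂ ⊎ Constant)
  separatedPair {g} {g′} g≢g′ with any? (λ c → ¬? (f g ≟ f c))
  ... | yes (c , fg≢fc) = g , c , fg≢fc ∘ cong f , inj₁ fg≢fc
  ... | no ∄c = g , g′ , g≢g′ , inj₂ λ c c′ → trans (sym (agrees c)) (agrees c′)
    where
    agrees : ∀ c → f g ≡ f c
    agrees c = decidable-stable (f g ≟ f c) (λ fg≢fc → ∄c (c , fg≢fc))

lemma5p2 : (m n : ℕ) → 2 ≤ m → 2 ≤ n → (f : Fin m → Fin n) →
    (m ≤ n →
      GpAtLeast (SierpAdj f) (sierpV f (n ∸ 1))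
      × (n ∸ m + 1) * m ≤ sierpV f (n ∸ 1))
    × (n ≤ m →
      GpAtLeast (SierpAdj f) ((2 * (n ∸ 1)) ⊔ m))
lemma5p2 (suc (suc m)) n (s≤s (s≤s _)) _ f =
  (λ m≤n → degreeSet-gp , sierpV-≥ (s≤s z≤n) m≤n) ,
  (λ _ → let g₁ , g₂ , g₁≢g₂ , separated = separatedPair {zero} {suc zero} (λ ())
         in gpAtLeast-⊔ (pairSet-gp g₁≢g₂ separated) extremeVertices-gp)
  where
  open Sierpiński f
  open WalkProperties (SierpAdj f)
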